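{- Let $f(x)=1+a_1x+a_2x^2+\cdots$ be a formal power series (with coefficients in a commutative ring) and for $i,j\ge0$ let $c_{i,j}=[x^j]\,f(x)^{2i+1}$ be the coefficient of $x^j$ in $f(x)^{2i+1}$. Then for every integer $N\ge0$, \[\det\left[c_{i,j}\right]_{0\le i,j\le N}=(2a_1)^{\frac{N(N+1)}{2}}.\]
   Context: The convention $(2a_1)^0=1$ is used. -}

module Defs where

open import Level using (Level)
open import Data.Nat using (ℕ; zero; suc; _∸_)
open import Data.Fin using (Fin; zero; suc; toℕ; punchIn)
open import Algebra.Bundles using (CommutativeRing)

module _ {c ℓ : Level} (R : CommutativeRing c ℓ) where
  open CommutativeRing R using (Carrier; _+_; _*_; -_; 0#; 1#)

  PowerSeries : Set c
  PowerSeries = ℕ → Carrier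

  sumFin : (n : ℕ) → (Fin n → Carrier) → Carrier
  sumFin zero    g = 0#
  sumFin (suc n) g = g zero + sumFin n (λ i → g (suc i))

  _⊛_ : PowerSeries → PowerSeries → PowerSeries
  (f ⊛ g) n = sumFin (suc n) (λ k → f (toℕ k) * g (n ∸ toℕ k))

  oneSeries : PowerSeries
  oneSeries zero    = 1#
  oneSeries (suc _) = 0#

  seriesPow : PowerSeries → ℕ → PowerSeries
  seriesPow f zero    = oneSeries
  seriesPow f (suc m) = f ⊛ seriesPow f m

  pow : Carrier → ℕ → Carrier
  pow x zero    = 1#
  pow x (suc m) = x * pow x m

  sign : ℕ → Carrier
  sign zero    = 1#
  sign (suc k) = - sign k

  det : (n : ℕ) → (Fin n → Fin n → Carrier) → Carrier
  det zero    M = 1#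
  det (suc n) M =
    sumFin (suc n) (λ j → sign (toℕ j) * (M zero j * det n (λ r s → M (suc r) (punchIn j s))))

{-# OPTIONS --safe #-}
-- Put g = f². Row i of the matrix lists the coefficients of g^i f, so subtracting from every row the
-- previous one, which keeps the determinant, turns rows 1, …, N into the coefficients of g^(i-1) (g - 1) f.
-- As g - 1 = 2a₁x + O(x²), these rows vanish in column 0, and expanding along that column leaves a
-- determinant of the same shape for (g - 1) f read from column 1 on, whose first coefficient is 2a₁ times
-- that of f. By induction the determinant is (2a₁)^0 (2a₁)^1 ⋯ (2a₁)^N.
module Submission where

open import Defs
open import Data.Fin using (Fin; toℕ)
open import Algebra.Bundles using (CommutativeRing)

open import Data.Nat.Base as ℕ using (ℕ; zero; suc; _∸_; _<_; s≤s)
import Data.Nat.Properties as ℕ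
open import Data.Nat.DivMod using (m*n/n≡m)
open import Data.Nat.Solver using (module +-*-Solver)
open import Data.Fin.Base using (zero; suc; punchIn)
open import Data.Vec.Functional using (Vector; _∷_)
open import Data.Maybe.Base using (nothing)
open import Function.Base using (_∘_)
open import Data.Sum.Base using (inj₁; inj₂)
open import Relation.Binary.PropositionalEquality as ≡ using (_≡_)
import Algebra.Properties.CommutativeMonoid.Sum as CommutativeMonoidSum
import Algebra.Properties.Semiring.Sum as SemiringSum
import Algebra.Properties.Semiring.Exp as SemiringExp
import Algebra.Properties.Ring as RingProperties
import Algebra.Properties.Group as GroupProperties
open import Tactic.RingSolver.Core.AlmostCommutativeRing using (fromCommutativeRing)
import Tactic.RingSolver.NonReflective as RingSolver
import Relation.Binary.Reasoning.Setoid as SetoidReasoning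

-- ℕ's _+_ and _*_ are opened only locally, as the ring operations below have the same names.
module _ where
  open import Data.Nat.Base using (_+_; _*_; _/_)

  sumFrom : ℕ → ℕ → ℕ
  sumFrom d zero    = 0
  sumFrom d (suc n) = d + sumFrom (suc d) n

  sumFrom-suc : ∀ d n → sumFrom (suc d) n ≡ n + sumFrom d n
  sumFrom-suc d zero    = ≡.refl
  sumFrom-suc d (suc n) = ≡.trans (≡.cong (suc d +_) (sumFrom-suc (suc d) n))
                                  (left-comm d n (sumFrom (suc d) n))
    where
    open +-*-Solver
    left-comm : ∀ d n s → suc d + (n + s) ≡ suc n + (d + s)
    left-comm = solve 3 (λ d n s → (con 1 :+ d) :+ (n :+ s) := (con 1 :+ n) :+ (d :+ s)) ≡.refl

  sumFrom-zero-*2 : ∀ N → sumFrom 0 (suc N) * 2 ≡ N * suc N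
  sumFrom-zero-*2 zero    = ≡.refl
  sumFrom-zero-*2 (suc N) = begin
    sumFrom 1 (suc N) * 2               ≡⟨ ≡.cong (_* 2) (sumFrom-suc 0 (suc N)) ⟩
    (suc N + sumFrom 0 (suc N)) * 2     ≡⟨ ℕ.*-distribʳ-+ 2 (suc N) _ ⟩
    suc N * 2 + sumFrom 0 (suc N) * 2   ≡⟨ ≡.cong (suc N * 2 +_) (sumFrom-zero-*2 N) ⟩
    suc N * 2 + N * suc N               ≡⟨ step N ⟩
    suc N * suc (suc N)                 ∎
    where
    open ≡.≡-Reasoning
    open +-*-Solver
    step : ∀ N → suc N * 2 + N * suc N ≡ suc N * suc (suc N)
    step = solve 1 (λ N → (con 1 :+ N) :* con 2 :+ N :* (con 1 :+ N) := (con 1 :+ N) :* (con 2 :+ N)) ≡.refl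

  triangle : ∀ N → N * (N + 1) / 2 ≡ sumFrom 0 (suc N)
  triangle N = ≡.trans (≡.cong (_/ 2) (≡.trans (≡.cong (N *_) (ℕ.+-comm N 1)) (≡.sym (sumFrom-zero-*2 N))))
                       (m*n/n≡m (sumFrom 0 (suc N)) 2)

module _ {c ℓ} (R : CommutativeRing c ℓ) where
  open CommutativeRing R hiding (zero)
  open SetoidReasoning setoid
  open RingProperties ring using (-1*x≈-x)
  open GroupProperties +-group using (//-rightDividesˡ; //-rightDividesʳ)
  open CommutativeMonoidSum +-commutativeMonoid
    using (sum; sum-cong-≋; sum-cong-≗; sum-replicate-zero; ∑-distrib-+; ∑-comm)
  open SemiringSum semiring using (*-distribˡ-sum)
  open SemiringExp semiring using (_^_; ^-homo-*)

  sumFin≡sum : ∀ n (g : Vector Carrier n) → sumFin R n g ≡ sum g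
  sumFin≡sum zero    g = ≡.refl
  sumFin≡sum (suc n) g = ≡.cong (g zero +_) (sumFin≡sum n (g ∘ suc))

  sumFin-cong : ∀ n (g h : Vector Carrier n) → (∀ i → g i ≈ h i) → sumFin R n g ≈ sumFin R n h
  sumFin-cong n g h g≈h = begin
    sumFin R n g  ≡⟨ sumFin≡sum n g ⟩
    sum g         ≈⟨ sum-cong-≋ g≈h ⟩
    sum h         ≡⟨ sumFin≡sum n h ⟨
    sumFin R n h  ∎

  sumFin-zero : ∀ n (g : Vector Carrier n) → (∀ i → g i ≈ 0#) → sumFin R n g ≈ 0#
  sumFin-zero n g g≈0 = begin
    sumFin R n g        ≡⟨ sumFin≡sum n g ⟩
    sum g               ≈⟨ sum-cong-≋ g≈0 ⟩
    sum {n} (λ _ → 0#)  ≈⟨ sum-replicate-zero n ⟩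
    0#                  ∎

  sumFin-+ : ∀ n (g h : Vector Carrier n) → sumFin R n (λ i → g i + h i) ≈ sumFin R n g + sumFin R n h
  sumFin-+ n g h = begin
    sumFin R n (λ i → g i + h i)  ≡⟨ sumFin≡sum n _ ⟩
    sum (λ i → g i + h i)         ≈⟨ ∑-distrib-+ g h ⟩
    sum g + sum h                 ≡⟨ ≡.cong₂ _+_ (sumFin≡sum n g) (sumFin≡sum n h) ⟨
    sumFin R n g + sumFin R n h   ∎

  sumFin-*ˡ : ∀ n x (g : Vector Carrier n) → x * sumFin R n g ≈ sumFin R n (λ i → x * g i)
  sumFin-*ˡ n x g = begin
    x * sumFin R n g             ≡⟨ ≡.cong (x *_) (sumFin≡sum n g) ⟩
    x * sum g                    ≈⟨ *-distribˡ-sum x g ⟩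
    sum (λ i → x * g i)          ≡⟨ sumFin≡sum n _ ⟨
    sumFin R n (λ i → x * g i)   ∎

  sumFin-comm : ∀ m n (g : Fin m → Fin n → Carrier) →
                sumFin R m (λ i → sumFin R n (g i)) ≈ sumFin R n (λ j → sumFin R m (λ i → g i j))
  sumFin-comm m n g = begin
    sumFin R m (λ i → sumFin R n (g i))           ≡⟨ sumFin≡sum m _ ⟩
    sum (λ i → sumFin R n (g i))                  ≡⟨ sum-cong-≗ (λ i → sumFin≡sum n (g i)) ⟩
    sum (λ i → sum (g i))                         ≈⟨ ∑-comm g ⟩
    sum (λ j → sum (λ i → g i j))                 ≡⟨ sum-cong-≗ (λ j → sumFin≡sum m (λ i → g i j)) ⟨
    sum (λ j → sumFin R m (λ i → g i j))          ≡⟨ sumFin≡sum n _ ⟨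
    sumFin R n (λ j → sumFin R m (λ i → g i j))   ∎

  pow≡^ : ∀ x n → pow R x n ≡ x ^ n
  pow≡^ x zero    = ≡.refl
  pow≡^ x (suc n) = ≡.cong (x *_) (pow≡^ x n)

  pow-+ : ∀ x m n → pow R x (m ℕ.+ n) ≈ pow R x m * pow R x n
  pow-+ x m n = begin
    pow R x (m ℕ.+ n)        ≡⟨ pow≡^ x (m ℕ.+ n) ⟩
    x ^ (m ℕ.+ n)            ≈⟨ ^-homo-* x m n ⟩
    x ^ m * x ^ n            ≡⟨ ≡.cong₂ _*_ (pow≡^ x m) (pow≡^ x n) ⟨
    pow R x m * pow R x n    ∎

  x*[y*z]≈0 : ∀ x y {z} → z ≈ 0# → x * (y * z) ≈ 0#
  x*[y*z]≈0 x y z≈0 = trans (*-congˡ (trans (*-congˡ z≈0) (zeroʳ y))) (zeroʳ x)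

  Matrix : ℕ → Set c
  Matrix n = Vector (Vector Carrier n) n

  minor : ∀ {n} → Fin (suc n) → Fin (suc n) → Matrix (suc n) → Matrix n
  minor i j M r s = M (punchIn i r) (punchIn j s)

  laplaceRow₀ laplaceCol₀ : ∀ {n} → Matrix (suc n) → Fin (suc n) → Carrier
  laplaceRow₀ M j = sign R (toℕ j) * (M zero j * det R _ (minor zero j M))
  laplaceCol₀ M i = sign R (toℕ i) * (M i zero * det R _ (minor i zero M))

  det-cong : ∀ {n} (M M′ : Matrix n) → (∀ i j → M i j ≈ M′ i j) → det R n M ≈ det R n M′
  det-cong {zero}  M M′ _    = refl
  det-cong {suc n} M M′ M≈M′ = sumFin-cong (suc n) (laplaceRow₀ M) (laplaceRow₀ M′) λ j →
    *-congˡ (*-cong (M≈M′ zero j) (det-cong (minor zero j M) (minor zero j M′) λ r s → M≈M′ (suc r) (punchIn j s)))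

  det-+-row₀ : ∀ {n} (u v w : Vector Carrier (suc n)) (T : Fin n → Vector Carrier (suc n)) →
               (∀ j → u j + v j ≈ w j) →
               det R (suc n) (u ∷ T) + det R (suc n) (v ∷ T) ≈ det R (suc n) (w ∷ T)
  det-+-row₀ {n} u v w T u+v≈w = begin
    det R (suc n) (u ∷ T) + det R (suc n) (v ∷ T)
      ≈⟨ sumFin-+ (suc n) (laplaceRow₀ (u ∷ T)) (laplaceRow₀ (v ∷ T)) ⟨
    sumFin R (suc n) (λ j → laplaceRow₀ (u ∷ T) j + laplaceRow₀ (v ∷ T) j)
      ≈⟨ sumFin-cong (suc n) _ (laplaceRow₀ (w ∷ T)) additive ⟩
    det R (suc n) (w ∷ T)  ∎
    where
    additive : ∀ j → laplaceRow₀ (u ∷ T) j + laplaceRow₀ (v ∷ T) j ≈ laplaceRow₀ (w ∷ T) j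
    additive j = trans (sym (distribˡ _ _ _)) (*-congˡ (trans (sym (distribʳ _ (u j) (v j))) (*-congʳ (u+v≈w j))))

  det-expand-col₀ : ∀ n (M : Matrix (suc n)) → det R (suc n) M ≈ sumFin R (suc n) (laplaceCol₀ M)
  det-expand-col₀ zero    M = refl
  det-expand-col₀ (suc n) M = +-congˡ (begin
    sumFin R (suc n) (λ j → laplaceRow₀ M (suc j))
      ≈⟨ sumFin-cong (suc n) _ (λ j → sumFin R (suc n) (X j)) expand-minor ⟩
    sumFin R (suc n) (λ j → sumFin R (suc n) (X j))
      ≈⟨ sumFin-comm (suc n) (suc n) X ⟩
    sumFin R (suc n) (λ i → sumFin R (suc n) (λ j → X j i))
      ≈⟨ sumFin-cong (suc n) _ (λ i → laplaceCol₀ M (suc i)) regroup ⟩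
    sumFin R (suc n) (λ i → laplaceCol₀ M (suc i))  ∎)
    where
    open RingSolver (fromCommutativeRing R (λ _ → nothing)) using (solve; _⊗_; ⊝_; _⊜_)
    s : ∀ {m} → Fin m → Carrier
    s i = sign R (toℕ i)
    a b : Fin (suc n) → Carrier
    a j = M zero (suc j)
    b i = M (suc i) zero
    D : Fin (suc n) → Fin (suc n) → Carrier
    D i j = det R n (λ r t → M (suc (punchIn i r)) (suc (punchIn j t)))
    X : Fin (suc n) → Fin (suc n) → Carrier
    X j i = (- s j) * (a j * (s i * (b i * D i j)))
    pull : ∀ x y (g : Fin (suc n) → Carrier) → x * (y * sumFin R (suc n) g) ≈ sumFin R (suc n) (λ i → x * (y * g i))
    pull x y g = trans (*-congˡ (sumFin-*ˡ (suc n) y g)) (sumFin-*ˡ (suc n) x (λ i → y * g i))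
    exchange : ∀ p q u v d → (- p) * (q * (u * (v * d))) ≈ (- u) * (v * (p * (q * d)))
    exchange = solve 5 (λ p q u v d → (⊝ p) ⊗ (q ⊗ (u ⊗ (v ⊗ d))) ⊜ (⊝ u) ⊗ (v ⊗ (p ⊗ (q ⊗ d)))) refl
    expand-minor : ∀ j → laplaceRow₀ M (suc j) ≈ sumFin R (suc n) (X j)
    expand-minor j = trans (*-congˡ (*-congˡ (det-expand-col₀ n (minor zero (suc j) M))))
                           (pull (- s j) (a j) (λ i → s i * (b i * D i j)))
    regroup : ∀ i → sumFin R (suc n) (λ j → X j i) ≈ laplaceCol₀ M (suc i)
    regroup i = trans (sumFin-cong (suc n) _ _ (λ j → exchange (s j) (a j) (s i) (b i) (D i j)))
                      (sym (pull (- s i) (b i) (λ j → s j * (a j * D i j))))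

  -- det is defined by expansion along row 0, so the alternating property comes from the expansion along
  -- column 0: there the terms of rows 0 and 1 cancel, and every other minor again has two equal top rows.
  det-duplicate-row₀ : ∀ n (u : Vector Carrier (suc (suc n))) (T : Fin n → Vector Carrier (suc (suc n))) →
                       det R (suc (suc n)) (u ∷ u ∷ T) ≈ 0#
  det-duplicate-row₀ n u T = begin
    det R (suc (suc n)) (u ∷ u ∷ T)                 ≈⟨ det-expand-col₀ (suc n) (u ∷ u ∷ T) ⟩
    1# * t + (- 1# * t + rest)                      ≈⟨ +-cong (*-identityˡ t) (+-cong (-1*x≈-x t) (rest≈0 n u T)) ⟩
    t + (- t + 0#)                                  ≈⟨ +-congˡ (+-identityʳ (- t)) ⟩
    t - t                                           ≈⟨ -‿inverseʳ t ⟩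
    0#                                              ∎
    where
    t = u zero * det R (suc n) (minor zero zero (u ∷ u ∷ T))
    rest = sumFin R n (λ i → laplaceCol₀ (u ∷ u ∷ T) (suc (suc i)))
    rest≈0 : ∀ n (u : Vector Carrier (suc (suc n))) (T : Fin n → Vector Carrier (suc (suc n))) →
             sumFin R n (λ i → laplaceCol₀ (u ∷ u ∷ T) (suc (suc i))) ≈ 0#
    rest≈0 zero    u T = refl
    rest≈0 (suc n) u T = sumFin-zero (suc n) (λ i → laplaceCol₀ (u ∷ u ∷ T) (suc (suc i))) λ i →
      x*[y*z]≈0 (sign R (toℕ (suc (suc i)))) (T i zero) (det-duplicate-row₀ n (u ∘ suc) (λ r → T (punchIn i r) ∘ suc))

  det-add-row₀-to-row₁ : ∀ {n} (u v w : Vector Carrier (suc (suc n))) (T : Fin n → Vector Carrier (suc (suc n))) →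
                         (∀ j → v j + u j ≈ w j) →
                         det R (suc (suc n)) (u ∷ v ∷ T) ≈ det R (suc (suc n)) (u ∷ w ∷ T)
  det-add-row₀-to-row₁ {n} u v w T v+u≈w = begin
    det R (suc (suc n)) (u ∷ v ∷ T)                                    ≈⟨ +-identityʳ _ ⟨
    det R (suc (suc n)) (u ∷ v ∷ T) + 0#                               ≈⟨ +-congˡ (det-duplicate-row₀ n u T) ⟨
    det R (suc (suc n)) (u ∷ v ∷ T) + det R (suc (suc n)) (u ∷ u ∷ T)
      ≈⟨ sumFin-+ (suc (suc n)) (laplaceRow₀ (u ∷ v ∷ T)) (laplaceRow₀ (u ∷ u ∷ T)) ⟨
    sumFin R (suc (suc n)) (λ j → laplaceRow₀ (u ∷ v ∷ T) j + laplaceRow₀ (u ∷ u ∷ T) j)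
      ≈⟨ sumFin-cong (suc (suc n)) _ (laplaceRow₀ (u ∷ w ∷ T)) additive ⟩
    det R (suc (suc n)) (u ∷ w ∷ T)                                    ∎
    where
    additive : ∀ j → laplaceRow₀ (u ∷ v ∷ T) j + laplaceRow₀ (u ∷ u ∷ T) j ≈ laplaceRow₀ (u ∷ w ∷ T) j
    additive j = trans (sym (distribˡ _ _ _)) (*-congˡ (trans (sym (distribˡ (u j) _ _)) (*-congˡ
      (det-+-row₀ (v ∘ punchIn j) (u ∘ punchIn j) (w ∘ punchIn j) (λ r → T r ∘ punchIn j) (v+u≈w ∘ punchIn j)))))

  det-col₀-zero-below : ∀ {n} (M : Matrix (suc n)) → (∀ i → M (suc i) zero ≈ 0#) →
                        det R (suc n) M ≈ M zero zero * det R n (minor zero zero M)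
  det-col₀-zero-below {n} M col₀≈0 = begin
    det R (suc n) M
      ≈⟨ det-expand-col₀ n M ⟩
    1# * (M zero zero * det R n (minor zero zero M)) + sumFin R n (λ i → laplaceCol₀ M (suc i))
      ≈⟨ +-cong (*-identityˡ _) (sumFin-zero n _ λ i →
           trans (*-congˡ (trans (*-congʳ (col₀≈0 i)) (zeroˡ _))) (zeroʳ _)) ⟩
    M zero zero * det R n (minor zero zero M) + 0#
      ≈⟨ +-identityʳ _ ⟩
    M zero zero * det R n (minor zero zero M)  ∎

  det-rowDifferences : ∀ n (A Q : ℕ → Vector Carrier n) →
                       (∀ j → A 0 j ≈ Q 0 j) → (∀ i j → A (suc i) j + Q i j ≈ Q (suc i) j) →
                       det R n (A ∘ toℕ) ≈ det R n (Q ∘ toℕ)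
  det-rowDifferences zero          A Q A₀≈Q₀ _    = refl
  det-rowDifferences (suc zero)    A Q A₀≈Q₀ _    = det-cong (A ∘ toℕ) (Q ∘ toℕ) λ where
    zero j → A₀≈Q₀ j
  det-rowDifferences (suc (suc n)) A Q A₀≈Q₀ step = begin
    det R (suc (suc n)) (A ∘ toℕ)
      ≈⟨ det-cong (A ∘ toℕ) (Q 0 ∷ A 1 ∷ T) (λ where
           zero          j → A₀≈Q₀ j
           (suc zero)    j → refl
           (suc (suc i)) j → refl) ⟩
    det R (suc (suc n)) (Q 0 ∷ A 1 ∷ T)
      ≈⟨ det-add-row₀-to-row₁ (Q 0) (A 1) (Q 1) T (step 0) ⟩
    det R (suc (suc n)) (Q 0 ∷ Q 1 ∷ T)
      ≈⟨ sumFin-cong (suc (suc n)) _ (laplaceRow₀ (Q ∘ toℕ)) (λ j → *-congˡ (*-congˡ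
           (det-rowDifferences (suc n) (A′ j) (Q′ j) (λ _ → refl) (λ i → step (suc i) ∘ punchIn j)))) ⟩
    det R (suc (suc n)) (Q ∘ toℕ)  ∎
    where
    T : Fin n → Vector Carrier (suc (suc n))
    T i = A (suc (suc (toℕ i)))
    A′ Q′ : Fin (suc (suc n)) → ℕ → Vector Carrier (suc n)
    A′ j zero    = Q 1 ∘ punchIn j
    A′ j (suc i) = A (suc (suc i)) ∘ punchIn j
    Q′ j i       = Q (suc i) ∘ punchIn j

  infixr 7 _⋆_
  _⋆_ : PowerSeries R → PowerSeries R → PowerSeries R
  _⋆_ = _⊛_ R

  VanishesBelow : ℕ → PowerSeries R → Set ℓ
  VanishesBelow s p = ∀ j → j < s → p j ≈ 0#

  ⋆-congʳ : ∀ f {p q : PowerSeries R} → (∀ n → p n ≈ q n) → ∀ n → (f ⋆ p) n ≈ (f ⋆ q) n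
  ⋆-congʳ f {p} {q} p≈q n =
    sumFin-cong (suc n) (λ k → f (toℕ k) * p (n ∸ toℕ k)) (λ k → f (toℕ k) * q (n ∸ toℕ k)) λ k →
      *-congˡ (p≈q (n ∸ toℕ k))

  ⋆-distribˡ-+ : ∀ f (p q : PowerSeries R) n → (f ⋆ (λ m → p m + q m)) n ≈ (f ⋆ p) n + (f ⋆ q) n
  ⋆-distribˡ-+ f p q n = trans
    (sumFin-cong (suc n) (λ k → f (toℕ k) * (p (n ∸ toℕ k) + q (n ∸ toℕ k)))
                 (λ k → f (toℕ k) * p (n ∸ toℕ k) + f (toℕ k) * q (n ∸ toℕ k)) (λ k → distribˡ _ _ _))
    (sumFin-+ (suc n) (λ k → f (toℕ k) * p (n ∸ toℕ k)) (λ k → f (toℕ k) * q (n ∸ toℕ k)))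

  ⋆-vanishesBelow : ∀ f {s p} → VanishesBelow s p → VanishesBelow s (f ⋆ p)
  ⋆-vanishesBelow f {p = p} p≈0 j j<s = sumFin-zero (suc j) (λ k → f (toℕ k) * p (j ∸ toℕ k)) λ k →
    trans (*-congˡ (p≈0 (j ∸ toℕ k) (ℕ.≤-<-trans (ℕ.m∸n≤m j (toℕ k)) j<s))) (zeroʳ _)

  ⋆-at-order : ∀ f {s p} → VanishesBelow s p → (f ⋆ p) s ≈ f 0 * p s
  ⋆-at-order f {zero}      p≈0 = +-identityʳ _
  ⋆-at-order f {suc s} {p} p≈0 = trans (+-congˡ (sumFin-zero (suc s) (λ k → f (suc (toℕ k)) * p (s ∸ toℕ k)) λ k →
    trans (*-congˡ (p≈0 (s ∸ toℕ k) (s≤s (ℕ.m∸n≤m s (toℕ k))))) (zeroʳ _))) (+-identityʳ _)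

  module ConstantTermOne (f : PowerSeries R) (f₀≈1 : f 0 ≈ 1#) where

    infixr 7 [f²-1]⋆_

    [f²]^ : ℕ → PowerSeries R → PowerSeries R
    [f²]^ zero    p = p
    [f²]^ (suc i) p = f ⋆ f ⋆ [f²]^ i p

    [f²-1]⋆_ : PowerSeries R → PowerSeries R
    ([f²-1]⋆ p) n = (f ⋆ f ⋆ p) n - p n

    f₊ : PowerSeries R
    f₊ n = f (suc n)

    2f₁ : Carrier
    2f₁ = f 1 + f 1

    f⋆-at-order : ∀ {s p} → VanishesBelow s p → (f ⋆ p) s ≈ p s
    f⋆-at-order p≈0 = trans (⋆-at-order f p≈0) (trans (*-congʳ f₀≈1) (*-identityˡ _))

    [f²]^-cong : ∀ i {p q} → (∀ n → p n ≈ q n) → ∀ n → [f²]^ i p n ≈ [f²]^ i q n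
    [f²]^-cong zero    p≈q = p≈q
    [f²]^-cong (suc i) p≈q = ⋆-congʳ f (⋆-congʳ f ([f²]^-cong i p≈q))

    [f²]^-distrib-+ : ∀ i (p q : PowerSeries R) n → [f²]^ i (λ m → p m + q m) n ≈ [f²]^ i p n + [f²]^ i q n
    [f²]^-distrib-+ zero    p q n = refl
    [f²]^-distrib-+ (suc i) p q n = trans
      (⋆-congʳ f (λ m → trans (⋆-congʳ f ([f²]^-distrib-+ i p q) m) (⋆-distribˡ-+ f ([f²]^ i p) ([f²]^ i q) m)) n)
      (⋆-distribˡ-+ f (f ⋆ [f²]^ i p) (f ⋆ [f²]^ i q) n)

    [f²]^-suc : ∀ i p → [f²]^ i (f ⋆ f ⋆ p) ≡ [f²]^ (suc i) p
    [f²]^-suc zero    p = ≡.refl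
    [f²]^-suc (suc i) p = ≡.cong (λ q → f ⋆ f ⋆ q) ([f²]^-suc i p)

    [f²]^-seriesPow : ∀ i m → [f²]^ i (seriesPow R f m) ≡ seriesPow R f (i ℕ.* 2 ℕ.+ m)
    [f²]^-seriesPow zero    m = ≡.refl
    [f²]^-seriesPow (suc i) m = ≡.cong (λ q → f ⋆ f ⋆ q) ([f²]^-seriesPow i m)

    [f²]^-vanishesBelow : ∀ i {s p} → VanishesBelow s p → VanishesBelow s ([f²]^ i p)
    [f²]^-vanishesBelow zero    p≈0 = p≈0
    [f²]^-vanishesBelow (suc i) p≈0 = ⋆-vanishesBelow f (⋆-vanishesBelow f ([f²]^-vanishesBelow i p≈0))

    [f²-1]-vanishesBelow : ∀ {s p} → VanishesBelow s p → VanishesBelow (suc s) ([f²-1]⋆ p)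
    [f²-1]-vanishesBelow {s} {p} p≈0 j j<1+s with ℕ.m<1+n⇒m<n∨m≡n j<1+s
    ... | inj₁ j<s    = trans (+-cong ([f²]^-vanishesBelow 1 p≈0 j j<s) (-‿cong (p≈0 j j<s))) (-‿inverseʳ 0#)
    ... | inj₂ ≡.refl =
      trans (+-congʳ (trans (f⋆-at-order (⋆-vanishesBelow f p≈0)) (f⋆-at-order p≈0))) (-‿inverseʳ (p s))

    [f²-1]-leading : ∀ {s p} → VanishesBelow s p → ([f²-1]⋆ p) (suc s) ≈ 2f₁ * p s
    [f²-1]-leading {s} {p} p≈0 = begin
      -- (f ⋆ q) (suc n) unfolds definitionally to f 0 * q (suc n) + (f₊ ⋆ q) n.
      (f 0 * (f 0 * p (suc s) + (f₊ ⋆ p) s) + (f₊ ⋆ f ⋆ p) s) - p (suc s)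
        ≈⟨ +-congʳ (+-cong (trans (*-cong f₀≈1 f⋆p-at-suc) (*-identityˡ _)) f₊⋆f⋆p-at) ⟩
      ((p (suc s) + f 1 * p s) + f 1 * p s) - p (suc s)
        ≈⟨ +-congʳ (trans (+-assoc _ _ _) (+-comm _ _)) ⟩
      (f 1 * p s + f 1 * p s + p (suc s)) - p (suc s)
        ≈⟨ //-rightDividesʳ (p (suc s)) _ ⟩
      f 1 * p s + f 1 * p s
        ≈⟨ distribʳ (p s) (f 1) (f 1) ⟨
      2f₁ * p s  ∎
      where
      f⋆p-at-suc : f 0 * p (suc s) + (f₊ ⋆ p) s ≈ p (suc s) + f 1 * p s
      f⋆p-at-suc = +-cong (trans (*-congʳ f₀≈1) (*-identityˡ _)) (⋆-at-order f₊ p≈0)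
      f₊⋆f⋆p-at : (f₊ ⋆ f ⋆ p) s ≈ f 1 * p s
      f₊⋆f⋆p-at = trans (⋆-at-order f₊ (⋆-vanishesBelow f p≈0)) (*-congˡ (f⋆-at-order p≈0))

    [f²-1]⋆-+ : ∀ p n → ([f²-1]⋆ p) n + p n ≈ (f ⋆ f ⋆ p) n
    [f²-1]⋆-+ p n = //-rightDividesˡ (p n) ((f ⋆ f ⋆ p) n)

    [f²]^-[f²-1]⋆-+ : ∀ i p n → [f²]^ i ([f²-1]⋆ p) n + [f²]^ i p n ≈ [f²]^ (suc i) p n
    [f²]^-[f²-1]⋆-+ i p n = begin
      [f²]^ i ([f²-1]⋆ p) n + [f²]^ i p n         ≈⟨ [f²]^-distrib-+ i ([f²-1]⋆ p) p n ⟨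
      [f²]^ i (λ m → ([f²-1]⋆ p) m + p m) n      ≈⟨ [f²]^-cong i ([f²-1]⋆-+ p) n ⟩
      [f²]^ i (f ⋆ f ⋆ p) n                       ≡⟨ ≡.cong (λ q → q n) ([f²]^-suc i p) ⟩
      [f²]^ (suc i) p n                           ∎

    det-[f²]^ : ∀ n c h → VanishesBelow c h → h c ≈ pow R 2f₁ c →
                       det R n (λ i j → [f²]^ (toℕ i) h (toℕ j ℕ.+ c)) ≈ pow R 2f₁ (sumFrom c n)
    det-[f²]^ zero    c h _   _    = refl
    det-[f²]^ (suc n) c h h≈0 h₀≈ = begin
      det R (suc n) (Q ∘ toℕ)
        ≈⟨ det-rowDifferences (suc n) A Q (λ _ → refl) (λ i j → [f²]^-[f²-1]⋆-+ i h (toℕ j ℕ.+ c)) ⟨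
      det R (suc n) (A ∘ toℕ)
        ≈⟨ det-col₀-zero-below (A ∘ toℕ) (λ i → [f²]^-vanishesBelow (toℕ i) h′≈0 c (ℕ.n<1+n c)) ⟩
      h c * det R n (minor zero zero (A ∘ toℕ))
        ≈⟨ *-cong h₀≈ (det-cong {n} _ _ λ r s →
             reflexive (≡.cong ([f²]^ (toℕ r) h′) (≡.sym (ℕ.+-suc (toℕ s) c)))) ⟩
      pow R 2f₁ c * det R n (λ r s → [f²]^ (toℕ r) h′ (toℕ s ℕ.+ suc c))
        ≈⟨ *-congˡ (det-[f²]^ n (suc c) h′ h′≈0 (trans ([f²-1]-leading h≈0) (*-congˡ h₀≈))) ⟩
      pow R 2f₁ c * pow R 2f₁ (sumFrom (suc c) n)
        ≈⟨ pow-+ 2f₁ c (sumFrom (suc c) n) ⟨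
      pow R 2f₁ (sumFrom c (suc n))  ∎
      where
      h′ : PowerSeries R
      h′ = [f²-1]⋆ h
      h′≈0 : VanishesBelow (suc c) h′
      h′≈0 = [f²-1]-vanishesBelow h≈0
      Q A : ℕ → Vector Carrier (suc n)
      Q i j       = [f²]^ i h (toℕ j ℕ.+ c)
      A zero j    = h (toℕ j ℕ.+ c)
      A (suc i) j = [f²]^ i h′ (toℕ j ℕ.+ c)

    det-oddPowers : ∀ N → det R (suc N) (λ i j → seriesPow R f (2 ℕ.* toℕ i ℕ.+ 1) (toℕ j))
                          ≈ pow R 2f₁ (sumFrom 0 (suc N))
    det-oddPowers N = begin
      det R (suc N) (λ i j → seriesPow R f (2 ℕ.* toℕ i ℕ.+ 1) (toℕ j))
        ≈⟨ det-cong {suc N} _ _ (λ i j → reflexive (odd-power (toℕ i) (toℕ j))) ⟩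
      det R (suc N) (λ i j → [f²]^ (toℕ i) (seriesPow R f 1) (toℕ j ℕ.+ 0))
        ≈⟨ det-[f²]^ (suc N) 0 (seriesPow R f 1) (λ _ ()) f¹₀≈1 ⟩
      pow R 2f₁ (sumFrom 0 (suc N))  ∎
      where
      f¹₀≈1 : seriesPow R f 1 0 ≈ 1#
      f¹₀≈1 = trans (+-identityʳ _) (trans (*-identityʳ _) f₀≈1)
      odd-power : ∀ i j → seriesPow R f (2 ℕ.* i ℕ.+ 1) j ≡ [f²]^ i (seriesPow R f 1) (j ℕ.+ 0)
      odd-power i j =
        ≡.trans (≡.cong₂ (seriesPow R f) (≡.cong (ℕ._+ 1) (ℕ.*-comm 2 i)) (≡.sym (ℕ.+-identityʳ j)))
                (≡.cong (λ q → q (j ℕ.+ 0)) (≡.sym ([f²]^-seriesPow i 1)))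

open import Data.Nat using (ℕ; zero; suc; _+_; _*_; _/_)

lemma8p2 : ∀ {c ℓ} (R : CommutativeRing c ℓ) (f : PowerSeries R) →
    CommutativeRing._≈_ R (f 0) (CommutativeRing.1# R) →
    (N : ℕ) →
    CommutativeRing._≈_ R
      (det R (suc N) (λ i j → seriesPow R f (2 * toℕ i + 1) (toℕ j)))
      (pow R (CommutativeRing._+_ R (f 1) (f 1)) ((N * (N + 1)) / 2))
lemma8p2 R f f₀≈1 N = begin
  det R (suc N) (λ i j → seriesPow R f (2 * toℕ i + 1) (toℕ j))  ≈⟨ det-oddPowers N ⟩
  pow R 2f₁ (sumFrom 0 (suc N))                                    ≡⟨ ≡.cong (pow R 2f₁) (triangle N) ⟨
  pow R 2f₁ (N * (N + 1) / 2)                                      ∎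
  where
  open SetoidReasoning (CommutativeRing.setoid R)
  open ConstantTermOne R f f₀≈1 using (2f₁; det-oddPowers)
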